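{- Let $k\geq 2$ and $n\geq 0$. The set of short $k$-Catalan--Spitzer permutations of order $n$ equals the set of all permutations obtained by the following procedure: take a $k$-Catalan path of order $n$, label its $(k-1)n$ up steps bijectively with $1,\ldots,(k-1)n$ so that the labels increase from right to left among up steps at the same level and every up step at a lower level receives a smaller label than every up step at a higher level, and record the labels of the up steps in the order they occur along the path.
   Context: A $k$-Catalan path of order $n$ is a lattice path from $(0,0)$ to $(kn,0)$ consisting of $(k-1)n$ up steps $(1,1)$ and $n$ down steps $(1,1-k)$ that never goes below the $x$-axis; the level of an up step is the $y$-coordinate of its starting point. A $k$-Catalan--Spitzer path of order $n$ is a lattice path $(0,z'_0),(1,z'_1),\ldots,(kn+1,z'_{kn+1})$ with $z'_0=z'_{kn+1}=0$, consisting of $(k-1)n+1$ up steps $(1,n)$ and $n$ down steps $(1,-((k-1)n+1))$, with $z'_i>0$ for $1\leq i\leq kn$. Given such a path let $i_1<\cdots<i_{(k-1)n}$ be the indices $i\in\{1,\ldots,kn\}$ with $z'_i<z'_{i+1}$. Its short $k$-Catalan--Spitzer permutation is the permutation $\sigma$ of $\{1,\ldots,(k-1)n\}$ with $\sigma(a)<\sigma(b)$ iff $z'_{i_a}<z'_{i_b}$. -}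

module Defs where

open import Data.Bool using (Bool; true; false; if_then_else_)
open import Data.Nat as ℕ using (ℕ; zero; suc; _*_; _∸_; _≤_)
open import Data.Integer as ℤ using (ℤ; +_; _<?_)
open import Data.List using (List; []; _∷_; take; drop; tabulate)
open import Data.List.Relation.Unary.All using (All)
open import Data.Fin as Fin using (Fin)
open import Data.Product using (Σ; _×_; ∃)
open import Relation.Nullary.Decidable using (⌊_⌋)
open import Relation.Binary.PropositionalEquality using (_≡_)
open import Function.Definitions using (Bijective)
open import Function.Bundles using (_⇔_)

-- A lattice path is a list of steps: true = up step, false = down step.
Path : Set
Path = List Bool

ups : Path → ℕ
ups []           = 0
ups (true ∷ s)   = suc (ups s)
ups (false ∷ s)  = ups s

downs : Path → ℕ
downs []          = 0
downs (true ∷ s)  = downs s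
downs (false ∷ s) = suc (downs s)

heights : ℤ → ℤ → ℤ → Path → List ℤ
heights u d h []          = h ∷ []
heights u d h (true ∷ s)  = h ∷ heights u d (h ℤ.+ u) s
heights u d h (false ∷ s) = h ∷ heights u d (h ℤ.- d) s

rises : List ℤ → List ℤ
rises []            = []
rises (x ∷ [])      = []
rises (x ∷ y ∷ r)   = if ⌊ x <? y ⌋ then x ∷ rises (y ∷ r) else rises (y ∷ r)

catHeights : ℕ → Path → List ℤ
catHeights k s = heights (+ 1) (+ (k ∸ 1)) (+ 0) s

IsCatalanPath : ℕ → ℕ → Path → Set
IsCatalanPath k n s =
  ups s ≡ (k ∸ 1) * n × downs s ≡ n × All (ℤ._≤_ (+ 0)) (catHeights k s)

csHeights : ℕ → ℕ → Path → List ℤ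
csHeights k n s = heights (+ n) (+ suc ((k ∸ 1) * n)) (+ 0) s

IsCSPath : ℕ → ℕ → Path → Set
IsCSPath k n s =
  ups s ≡ suc ((k ∸ 1) * n) × downs s ≡ n
  × All (ℤ._<_ (+ 0)) (drop 1 (take (suc (k * n)) (csHeights k n s)))   -- z'_i > 0, 1 ≤ i ≤ kn
  × drop (suc (k * n)) (csHeights k n s) ≡ (+ 0) ∷ []                   -- z'_{kn+1} = 0

-- Permutations of {1,…,(k-1)n} are represented 0-based as bijections of Fin ((k-1)n).
Perm : ℕ → Set
Perm m = Fin m → Fin m

IsShortCSPerm : (k n : ℕ) → Perm ((k ∸ 1) * n) → Set
IsShortCSPerm k n σ =
  Σ Path λ s → IsCSPath k n s ×
  Σ (Fin ((k ∸ 1) * n) → ℤ) λ ℓ →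
    tabulate ℓ ≡ rises (drop 1 (csHeights k n s)) ×
    Bijective _≡_ _≡_ σ ×
    (∀ a b → (σ a Fin.< σ b) ⇔ (ℓ a ℤ.< ℓ b))

-- σ arises from the labelling procedure: σ a is the label of the a-th up step
-- (in path order) of a k-Catalan path, whose level is ℓ a.
IsLabelledCatalanPerm : (k n : ℕ) → Perm ((k ∸ 1) * n) → Set
IsLabelledCatalanPerm k n σ =
  Σ Path λ s → IsCatalanPath k n s ×
  Σ (Fin ((k ∸ 1) * n) → ℤ) λ ℓ →
    tabulate ℓ ≡ rises (catHeights k s) ×
    Bijective _≡_ _≡_ σ ×
    (∀ a b → ℓ a ≡ ℓ b → a Fin.< b → σ b Fin.< σ a) ×
    (∀ a b → ℓ a ℤ.< ℓ b → σ a Fin.< σ b)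

-- Write K = k − 1 and m = K n + 1. Since z'_1 > 0, a Catalan–Spitzer path starts with an up
-- step, and the remaining kn steps form a path t with K n up and n down steps. If t has made u up
-- and d down steps, its Catalan height is c = u − d K while the Catalan–Spitzer height is
-- n + u n − d m = n c + (n − d). As 0 ≤ n − d ≤ n, with n − d = 0 only after the last down
-- step, the Catalan–Spitzer heights are positive and end at 0 exactly when the Catalan heights
-- are nonnegative, so removing the first step is a bijection between the two kinds of paths.
-- In both, the rises are the starting levels of the up steps. Two up steps a < b at the same
-- Catalan level have d_a < d_b, so b starts lower in the Catalan–Spitzer path; an up step at a
-- lower Catalan level c_a < c_b also starts lower, because n − d lies in (0, n] before the last
-- down step. So the order of Catalan–Spitzer levels is exactly the labelling rule.

module Submission where

open import Defs
open import Data.Bool using (true; false; if_then_else_)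
open import Data.Empty using (⊥-elim)
open import Data.Fin as F using (Fin; toℕ)
import Data.Fin.Properties as FP
open import Data.Integer as Z using (ℤ; +_; _<?_)
import Data.Integer.Properties as ZP
import Data.Integer.Tactic.RingSolver as ZS
open import Data.List using (List; []; _∷_; take; drop; tabulate; length)
open import Data.List.Properties using (∷-injectiveˡ; ∷-injectiveʳ)
open import Data.List.Relation.Unary.All using (All; []; _∷_)
open import Data.List.Relation.Unary.All.Properties using (tabulate⁻)
open import Data.Nat as N using (ℕ; zero; suc; _+_; _*_; _∸_; _≤_)
import Data.Nat.Properties as NP
import Data.Nat.Tactic.RingSolver as NS
import Data.Product as Product
open import Data.Product using (_×_; _,_)
open import Data.Sum using (_⊎_; inj₁; inj₂; [_,_])
open import Function.Base using (id)
open import Function.Bundles using (_⇔_; mk⇔; Equivalence)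
open import Relation.Binary using (tri<; tri≈; tri>)
open import Relation.Binary.PropositionalEquality hiding ([_])
open import Relation.Nullary using (¬_; yes; no)
open import Relation.Nullary.Decidable using (⌊_⌋)

upLevels : ℤ → ℤ → ℤ → Path → List ℤ
upLevels U D h []          = []
upLevels U D h (true ∷ t)  = h ∷ upLevels U D (h Z.+ U) t
upLevels U D h (false ∷ t) = upLevels U D (h Z.- D) t

All-upLevels : ∀ {P : ℤ → Set} U D h t → All P (heights U D h t) → All P (upLevels U D h t)
All-upLevels U D h []          _        = []
All-upLevels U D h (true ∷ t)  (p ∷ ps) = p ∷ All-upLevels U D (h Z.+ U) t ps
All-upLevels U D h (false ∷ t) (_ ∷ ps) = All-upLevels U D (h Z.- D) t ps

rises-∷-heights : ∀ U D x h t → rises (x ∷ heights U D h t) ≡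
  (if ⌊ x <? h ⌋ then x ∷ rises (heights U D h t) else rises (heights U D h t))
rises-∷-heights U D x h []          = refl
rises-∷-heights U D x h (true ∷ t)  = refl
rises-∷-heights U D x h (false ∷ t) = refl

rises-heights : ∀ a b h t → (ups t ≡ 0 ⊎ 0 N.< a) →
  rises (heights (+ a) (+ b) h t) ≡ upLevels (+ a) (+ b) h t
rises-heights a       b h []          _        = refl
rises-heights a       b h (true ∷ t)  (inj₁ ())
rises-heights (suc a) b h (true ∷ t)  (inj₂ a>0)
  rewrite rises-∷-heights (+ suc a) (+ b) h (h Z.+ + suc a) t with h <? h Z.+ + suc a
... | yes _    = cong (h ∷_) (rises-heights (suc a) b _ t (inj₂ a>0))
... | no h≮h+a = ⊥-elim (h≮h+a (subst (Z._< h Z.+ + suc a) (ZP.+-identityʳ h) (ZP.+-monoʳ-< h (Z.+<+ N.z<s))))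
rises-heights a       b h (false ∷ t) ups≡0∨a>0
  rewrite rises-∷-heights (+ a) (+ b) h (h Z.- + b) t with h <? h Z.- + b
... | yes h<h-b = ⊥-elim (ZP.<-irrefl refl (ZP.<-≤-trans h<h-b (ZP.i-j≤i h (+ b))))
... | no _      = rises-heights a b _ t ups≡0∨a>0

-- Up steps are indexed from 0.
downsBefore : Path → ℕ → ℕ
downsBefore []          i       = 0
downsBefore (true ∷ t)  zero    = 0
downsBefore (true ∷ t)  (suc i) = downsBefore t i
downsBefore (false ∷ t) i       = suc (downsBefore t i)

upLevels-tabulate : ∀ U D (g : ℕ → ℕ → ℤ) →
  (∀ u d → g (suc u) d ≡ g u d Z.+ U) → (∀ u d → g u (suc d) ≡ g u d Z.- D) →
  ∀ t → upLevels U D (g 0 0) t ≡ tabulate {n = ups t} (λ i → g (toℕ i) (downsBefore t (toℕ i)))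
upLevels-tabulate U D g g-up g-down [] = refl
upLevels-tabulate U D g g-up g-down (true ∷ t) = cong (g 0 0 ∷_) (begin
  upLevels U D (g 0 0 Z.+ U) t  ≡⟨ cong (λ h → upLevels U D h t) (sym (g-up 0 0)) ⟩
  upLevels U D (g 1 0) t        ≡⟨ upLevels-tabulate U D (λ u → g (suc u)) (λ u → g-up (suc u)) (λ u → g-down (suc u)) t ⟩
  _                             ∎)
  where open ≡-Reasoning
upLevels-tabulate U D g g-up g-down (false ∷ t) = begin
  upLevels U D (g 0 0 Z.- D) t  ≡⟨ cong (λ h → upLevels U D h t) (sym (g-down 0 0)) ⟩
  upLevels U D (g 0 1) t        ≡⟨ upLevels-tabulate U D (λ u d → g u (suc d)) (λ u d → g-up u (suc d)) (λ u d → g-down u (suc d)) t ⟩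
  _                             ∎
  where open ≡-Reasoning

tabulate-injective : ∀ {A : Set} {m} {f g : Fin m → A} → tabulate f ≡ tabulate g → ∀ i → f i ≡ g i
tabulate-injective {m = suc m} eq F.zero    = ∷-injectiveˡ eq
tabulate-injective {m = suc m} eq (F.suc i) = tabulate-injective (∷-injectiveʳ eq) i

length≡ups+downs : ∀ t → length t ≡ ups t + downs t
length≡ups+downs []          = refl
length≡ups+downs (true ∷ t)  = cong suc (length≡ups+downs t)
length≡ups+downs (false ∷ t) = trans (cong suc (length≡ups+downs t)) (sym (NP.+-suc (ups t) (downs t)))

-- The positivity condition of IsCSPath, applied below to the path after its first step.
PositiveThenZeroAt : ℕ → List ℤ → Set
PositiveThenZeroAt L hs = All (Z._<_ (+ 0)) (take L hs) × drop L hs ≡ + 0 ∷ []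

PositiveThenZero : ℤ → ℤ → ℤ → Path → Set
PositiveThenZero U D h t = PositiveThenZeroAt (length t) (heights U D h t)

take-heights-head : ∀ {P : ℤ → Set} U D h t L → 0 N.< L → All P (take L (heights U D h t)) → P h
take-heights-head U D h []          (suc L) _ (p ∷ _) = p
take-heights-head U D h (true ∷ t)  (suc L) _ (p ∷ _) = p
take-heights-head U D h (false ∷ t) (suc L) _ (p ∷ _) = p

private
  +e-e : ∀ x e → (x Z.+ e) Z.+ Z.- e ≡ x
  +e-e = ZS.solve-∀

module _ (a b e : ℤ) {p q : ℕ} (a+e≡p : a Z.+ e ≡ + p) (b+e≡q : b Z.+ e ≡ + q) where

  translate-< : (a Z.< b) ⇔ (p N.< q)
  translate-< = mk⇔
    (λ a<b → ZP.drop‿+<+ (subst₂ Z._<_ a+e≡p b+e≡q (ZP.+-monoˡ-< e a<b)))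
    (λ p<q → subst₂ Z._<_ (+e-e a e) (+e-e b e)
       (ZP.+-monoˡ-< (Z.- e) (subst₂ Z._<_ (sym a+e≡p) (sym b+e≡q) (Z.+<+ p<q))))

  translate-≤ : (a Z.≤ b) ⇔ (p ≤ q)
  translate-≤ = mk⇔
    (λ a≤b → ZP.drop‿+≤+ (subst₂ Z._≤_ a+e≡p b+e≡q (ZP.+-monoˡ-≤ e a≤b)))
    (λ p≤q → subst₂ Z._≤_ (+e-e a e) (+e-e b e)
       (ZP.+-monoˡ-≤ (Z.- e) (subst₂ Z._≤_ (sym a+e≡p) (sym b+e≡q) (Z.+≤+ p≤q))))

  translate-≡ : (a ≡ b) ⇔ (p ≡ q)
  translate-≡ = mk⇔
    (λ a≡b → ZP.+-injective (trans (sym a+e≡p) (trans (cong (Z._+ e) a≡b) b+e≡q)))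
    (λ p≡q → trans (sym (+e-e a e))
               (trans (cong (Z._- e) (trans a+e≡p (trans (cong +_ p≡q) (sym b+e≡q)))) (+e-e b e)))

heightAt : ℕ → ℕ → ℤ → ℕ → ℕ → ℤ
heightAt A B c u d = (+ (u * A) Z.- + (d * B)) Z.+ c

heightAt-up : ∀ A B c u d → heightAt A B c (suc u) d ≡ heightAt A B c u d Z.+ + A
heightAt-up A B c u d =
  trans (cong (λ z → (z Z.- + (d * B)) Z.+ c) (ZP.pos-+ A (u * A))) (regroup (+ A) (+ (u * A)) (+ (d * B)) c)
  where
  regroup : ∀ a x y c → ((a Z.+ x) Z.- y) Z.+ c ≡ ((x Z.- y) Z.+ c) Z.+ a
  regroup = ZS.solve-∀

heightAt-down : ∀ A B c u d → heightAt A B c u (suc d) ≡ heightAt A B c u d Z.- + B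
heightAt-down A B c u d =
  trans (cong (λ z → (+ (u * A) Z.- z) Z.+ c) (ZP.pos-+ B (d * B))) (regroup (+ B) (+ (u * A)) (+ (d * B)) c)
  where
  regroup : ∀ b x y c → (x Z.- (b Z.+ y)) Z.+ c ≡ ((x Z.- y) Z.+ c) Z.- b
  regroup = ZS.solve-∀

-- Both heights are translated by d B + d' B − c, which clears all subtractions.
module _ (A B : ℕ) (c : ℤ) (u d u' d' : ℕ) where

  private
    shift : ℤ
    shift = (+ (d * B) Z.+ + (d' * B)) Z.- c

    left+shift : heightAt A B c u d Z.+ shift ≡ + (u * A + d' * B)
    left+shift = trans (regroup (+ (u * A)) (+ (d * B)) (+ (d' * B)) c) (sym (ZP.pos-+ (u * A) (d' * B)))
      where
      regroup : ∀ x y y' c → ((x Z.- y) Z.+ c) Z.+ ((y Z.+ y') Z.- c) ≡ x Z.+ y'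
      regroup = ZS.solve-∀

    right+shift : heightAt A B c u' d' Z.+ shift ≡ + (u' * A + d * B)
    right+shift = trans (regroup (+ (u' * A)) (+ (d * B)) (+ (d' * B)) c) (sym (ZP.pos-+ (u' * A) (d * B)))
      where
      regroup : ∀ x y y' c → ((x Z.- y') Z.+ c) Z.+ ((y Z.+ y') Z.- c) ≡ x Z.+ y
      regroup = ZS.solve-∀

  heightAt-<⇔ : (heightAt A B c u d Z.< heightAt A B c u' d') ⇔ (u * A + d' * B N.< u' * A + d * B)
  heightAt-<⇔ = translate-< _ _ shift left+shift right+shift

  heightAt-≡⇔ : (heightAt A B c u d ≡ heightAt A B c u' d') ⇔ (u * A + d' * B ≡ u' * A + d * B)
  heightAt-≡⇔ = translate-≡ _ _ shift left+shift right+shift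

private
  x-y+c+y≡x+c : ∀ x y c → ((x Z.- y) Z.+ c) Z.+ y ≡ x Z.+ c
  x-y+c+y≡x+c = ZS.solve-∀

0≤heightAt⇔ : ∀ A B c u d → (+ 0 Z.≤ heightAt A B (+ c) u d) ⇔ (d * B ≤ u * A + c)
0≤heightAt⇔ A B c u d = translate-≤ _ _ (+ (d * B)) refl (x-y+c+y≡x+c (+ (u * A)) (+ (d * B)) (+ c))

0<heightAt⇔ : ∀ A B c u d → (+ 0 Z.< heightAt A B (+ c) u d) ⇔ (d * B N.< u * A + c)
0<heightAt⇔ A B c u d = translate-< _ _ (+ (d * B)) refl (x-y+c+y≡x+c (+ (u * A)) (+ (d * B)) (+ c))

heightAt≡0 : ∀ A B c u d → u * A + c ≡ d * B → heightAt A B (+ c) u d ≡ + 0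
heightAt≡0 A B c u d uA+c≡dB = begin
  (+ (u * A) Z.- + (d * B)) Z.+ + c          ≡⟨ cong (λ z → (+ (u * A) Z.- z) Z.+ + c) (cong +_ (sym uA+c≡dB)) ⟩
  (+ (u * A) Z.- + (u * A + c)) Z.+ + c      ≡⟨ cong (λ z → (+ (u * A) Z.- z) Z.+ + c) (ZP.pos-+ (u * A) c) ⟩
  (+ (u * A) Z.- (+ (u * A) Z.+ + c)) Z.+ + c ≡⟨ cancel (+ (u * A)) (+ c) ⟩
  + 0                                         ∎
  where
  open ≡-Reasoning
  cancel : ∀ x c → (x Z.- (x Z.+ c)) Z.+ c ≡ + 0
  cancel = ZS.solve-∀

monotone-agree : ∀ {N} {R : Fin N → Fin N → Set} → (∀ a b → a ≡ b ⊎ R a b ⊎ R b a) →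
  (σ : Fin N → Fin N) (ℓ : Fin N → ℤ) → (∀ {a b} → R a b → σ a F.< σ b) → (∀ {a b} → R a b → ℓ a Z.< ℓ b) →
  ∀ a b → (σ a F.< σ b) ⇔ (ℓ a Z.< ℓ b)
monotone-agree total σ ℓ σ-mono ℓ-mono a b with total a b
... | inj₁ refl        = mk⇔ (λ σa<σa → ⊥-elim (NP.<-irrefl refl σa<σa)) (λ ℓa<ℓa → ⊥-elim (ZP.<-irrefl refl ℓa<ℓa))
... | inj₂ (inj₁ Rab) = mk⇔ (λ _ → ℓ-mono Rab) (λ _ → σ-mono Rab)
... | inj₂ (inj₂ Rba) = mk⇔ (λ σa<σb → ⊥-elim (NP.<-asym σa<σb (σ-mono Rba)))
                             (λ ℓa<ℓb → ⊥-elim (ZP.<-asym ℓa<ℓb (ℓ-mono Rba)))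

-- csHeightAt u d = n · catHeightAt u d + (n − d), in subtraction-free form.
cross-term : ∀ K n u d → u * n + d * suc (K * n) ≡ (u * 1 + d * K) * n + d
cross-term = NS.solve-∀

module CatalanSpitzer (K n : ℕ) where

  m : ℕ
  m = suc (K * n)

  catHeightAt : ℕ → ℕ → ℤ
  catHeightAt = heightAt 1 K (+ 0)

  -- Heights of a Catalan–Spitzer path counted from the end of its first step, which is an up step.
  csHeightAt : ℕ → ℕ → ℤ
  csHeightAt = heightAt n m (+ n)

  private
    u*1+0≡u : ∀ u → u * 1 + 0 ≡ u
    u*1+0≡u u = trans (NP.+-identityʳ _) (NP.*-identityʳ u)

  0≤catHeightAt⇔0<csHeightAt : ∀ u d → u N.< K * n ⊎ d N.< n →
    (+ 0 Z.≤ catHeightAt u d) ⇔ (+ 0 Z.< csHeightAt u d)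
  0≤catHeightAt⇔0<csHeightAt u d u<Kn∨d<n = mk⇔
    (λ 0≤c → Equivalence.from (0<heightAt⇔ n m n u d) (to (Equivalence.to (0≤heightAt⇔ 1 K 0 u d) 0≤c)))
    (λ 0<s → Equivalence.from (0≤heightAt⇔ 1 K 0 u d) (from (Equivalence.to (0<heightAt⇔ n m n u d) 0<s)))
    where
    open NP.≤-Reasoning
    d*m≡ : d * m ≡ (d * K) * n + d
    d*m≡ = cross-term K n 0 d

    to : d * K ≤ u * 1 + 0 → d * m N.< u * n + n
    to dK≤u' = begin-strict
      d * m           ≡⟨ d*m≡ ⟩
      (d * K) * n + d <⟨ NP.+-mono-≤-< (NP.*-monoˡ-≤ n dK≤u) d<n ⟩
      u * n + n       ∎
      where
      dK≤u : d * K ≤ u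
      dK≤u = subst (d * K ≤_) (u*1+0≡u u) dK≤u'
      d<n : d N.< n
      d<n = [ (λ u<Kn → NP.*-cancelʳ-< K d n (NP.≤-<-trans dK≤u (subst (u N.<_) (NP.*-comm K n) u<Kn)))
            , id ] u<Kn∨d<n

    from : d * m N.< u * n + n → d * K ≤ u * 1 + 0
    from dm<un+n with d * K N.≤? u
    ... | yes dK≤u = subst (d * K ≤_) (sym (u*1+0≡u u)) dK≤u
    ... | no dK≰u  = ⊥-elim (NP.<⇒≱ dm<un+n (begin
      u * n + n       ≡⟨ NP.+-comm (u * n) n ⟩
      suc u * n       ≤⟨ NP.*-monoˡ-≤ n (NP.≰⇒> dK≰u) ⟩
      (d * K) * n     ≤⟨ NP.m≤m+n _ d ⟩
      (d * K) * n + d ≡⟨ d*m≡ ⟨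
      d * m           ∎))

  CatalanFrom : ℤ → Path → Set
  CatalanFrom h t = All (Z._≤_ (+ 0)) (heights (+ 1) (+ K) h t)

  private
    cons⇔ : ∀ {c s c' s' : ℤ} {t} → (+ 0 Z.≤ c) ⇔ (+ 0 Z.< s) →
      CatalanFrom c' t ⇔ PositiveThenZero (+ n) (+ m) s' t →
      All (Z._≤_ (+ 0)) (c ∷ heights (+ 1) (+ K) c' t) ⇔
        PositiveThenZeroAt (suc (length t)) (s ∷ heights (+ n) (+ m) s' t)
    cons⇔ head tail = mk⇔
      (λ { (0≤c ∷ cats) → Product.map₁ (Equivalence.to head 0≤c ∷_) (Equivalence.to tail cats) })
      (λ { (0<s ∷ poss , end) → Equivalence.from head 0<s ∷ Equivalence.from tail (poss , end) })

  catalan⇔positiveThenZero : ∀ t u d → u + ups t ≡ K * n → d + downs t ≡ n →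
    CatalanFrom (catHeightAt u d) t ⇔ PositiveThenZero (+ n) (+ m) (csHeightAt u d) t
  catalan⇔positiveThenZero [] u d u≡Kn d≡n = mk⇔ (λ _ → [] , cong (_∷ []) cs≡0) (λ _ → 0≤cat ∷ [])
    where
    open ≡-Reasoning
    u≡ : u ≡ K * n
    u≡ = trans (sym (NP.+-identityʳ u)) u≡Kn
    d≡ : d ≡ n
    d≡ = trans (sym (NP.+-identityʳ d)) d≡n
    0≤cat : + 0 Z.≤ catHeightAt u d
    0≤cat = Equivalence.from (0≤heightAt⇔ 1 K 0 u d) (NP.≤-reflexive (begin
      d * K     ≡⟨ cong (_* K) d≡ ⟩
      n * K     ≡⟨ NP.*-comm n K ⟩
      K * n     ≡⟨ sym u≡ ⟩
      u         ≡⟨ sym (u*1+0≡u u) ⟩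
      u * 1 + 0 ∎))
    cs≡0 : csHeightAt u d ≡ + 0
    cs≡0 = heightAt≡0 n m n u d (begin
      u * n + n           ≡⟨ cong (λ u → u * n + n) u≡ ⟩
      (K * n) * n + n     ≡⟨ corner K n ⟩
      n * m               ≡⟨ cong (_* m) (sym d≡) ⟩
      d * m               ∎)
      where
      corner : ∀ K n → (K * n) * n + n ≡ n * suc (K * n)
      corner = NS.solve-∀
  catalan⇔positiveThenZero (true ∷ t) u d u+ups≡Kn d+downs≡n =
    cons⇔ (0≤catHeightAt⇔0<csHeightAt u d (inj₁ u<Kn))
      (subst₂ (λ c s → CatalanFrom c t ⇔ PositiveThenZero (+ n) (+ m) s t)
        (heightAt-up 1 K (+ 0) u d) (heightAt-up n m (+ n) u d)
        (catalan⇔positiveThenZero t (suc u) d (trans (sym (NP.+-suc u (ups t))) u+ups≡Kn) d+downs≡n))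
    where
    u<Kn : u N.< K * n
    u<Kn = subst (u N.<_) u+ups≡Kn (NP.m<m+n u N.z<s)
  catalan⇔positiveThenZero (false ∷ t) u d u+ups≡Kn d+downs≡n =
    cons⇔ (0≤catHeightAt⇔0<csHeightAt u d (inj₂ d<n))
      (subst₂ (λ c s → CatalanFrom c t ⇔ PositiveThenZero (+ n) (+ m) s t)
        (heightAt-down 1 K (+ 0) u d) (heightAt-down n m (+ n) u d)
        (catalan⇔positiveThenZero t u (suc d) u+ups≡Kn (trans (sym (NP.+-suc d (downs t))) d+downs≡n)))
    where
    d<n : d N.< n
    d<n = subst (d N.<_) d+downs≡n (NP.m<m+n d N.z<s)

  catLevel : Path → Fin (K * n) → ℤ
  catLevel t a = catHeightAt (toℕ a) (downsBefore t (toℕ a))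

  csLevel : Path → Fin (K * n) → ℤ
  csLevel t a = csHeightAt (toℕ a) (downsBefore t (toℕ a))

  upLevels-catalan : ∀ t → ups t ≡ K * n → upLevels (+ 1) (+ K) (+ 0) t ≡ tabulate (catLevel t)
  upLevels-catalan t ups≡Kn =
    subst (λ N → upLevels (+ 1) (+ K) (+ 0) t ≡ tabulate {n = N} (λ a → catHeightAt (toℕ a) (downsBefore t (toℕ a))))
      ups≡Kn (upLevels-tabulate (+ 1) (+ K) catHeightAt (heightAt-up 1 K (+ 0)) (heightAt-down 1 K (+ 0)) t)

  upLevels-cs : ∀ t → ups t ≡ K * n → upLevels (+ n) (+ m) (+ n) t ≡ tabulate (csLevel t)
  upLevels-cs t ups≡Kn =
    subst (λ N → upLevels (+ n) (+ m) (+ n) t ≡ tabulate {n = N} (λ a → csHeightAt (toℕ a) (downsBefore t (toℕ a))))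
      ups≡Kn (upLevels-tabulate (+ n) (+ m) csHeightAt (heightAt-up n m (+ n)) (heightAt-down n m (+ n)) t)

  rises-catalan : ∀ t → ups t ≡ K * n → rises (heights (+ 1) (+ K) (+ 0) t) ≡ tabulate (catLevel t)
  rises-catalan t ups≡Kn = trans (rises-heights 1 K (+ 0) t (inj₂ N.z<s)) (upLevels-catalan t ups≡Kn)

  rises-cs : ∀ t → ups t ≡ K * n → rises (heights (+ n) (+ m) (+ n) t) ≡ tabulate (csLevel t)
  rises-cs t ups≡Kn = trans (rises-heights n m (+ n) t (ups≡0∨n>0 n ups≡Kn)) (upLevels-cs t ups≡Kn)
    where
    ups≡0∨n>0 : ∀ n′ → ups t ≡ K * n′ → ups t ≡ 0 ⊎ 0 N.< n′
    ups≡0∨n>0 zero    ups≡K0 = inj₁ (trans ups≡K0 (NP.*-zeroʳ K))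
    ups≡0∨n>0 (suc _) _      = inj₂ N.z<s

  downsBefore<n : ∀ t → CatalanFrom (+ 0) t → ups t ≡ K * n → (a : Fin (K * n)) → downsBefore t (toℕ a) N.< n
  downsBefore<n t cat ups≡Kn a = NP.*-cancelʳ-< K _ n (begin-strict
    da * K ≤⟨ dK≤a ⟩
    toℕ a  <⟨ FP.toℕ<n a ⟩
    K * n  ≡⟨ NP.*-comm K n ⟩
    n * K  ∎)
    where
    open NP.≤-Reasoning
    da : ℕ
    da = downsBefore t (toℕ a)
    0≤level : + 0 Z.≤ catLevel t a
    0≤level = tabulate⁻ (subst (All (Z._≤_ (+ 0))) (upLevels-catalan t ups≡Kn) (All-upLevels (+ 1) (+ K) (+ 0) t cat)) a
    dK≤a : da * K ≤ toℕ a
    dK≤a = subst (da * K ≤_) (u*1+0≡u (toℕ a)) (Equivalence.to (0≤heightAt⇔ 1 K 0 (toℕ a) da) 0≤level)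

  private
    sameLevel-ℕ : ∀ i j di dj → i * 1 + dj * K ≡ j * 1 + di * K → i N.< j → j * n + di * m N.< i * n + dj * m
    sameLevel-ℕ i j di dj eq i<j = begin-strict
      j * n + di * m            ≡⟨ cross-term K n j di ⟩
      (j * 1 + di * K) * n + di ≡⟨ cong (λ x → x * n + di) eq ⟨
      (i * 1 + dj * K) * n + di <⟨ NP.+-monoʳ-< _ di<dj ⟩
      (i * 1 + dj * K) * n + dj ≡⟨ cross-term K n i dj ⟨
      i * n + dj * m            ∎
      where
      open NP.≤-Reasoning
      di<dj : di N.< dj
      di<dj = NP.≰⇒> (λ dj≤di → NP.<-irrefl eq (NP.+-mono-<-≤ (NP.*-monoˡ-< 1 i<j) (NP.*-monoˡ-≤ K dj≤di)))

    lowerLevel-ℕ : ∀ i j di dj → i * 1 + dj * K N.< j * 1 + di * K → dj N.< n → i * n + dj * m N.< j * n + di * m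
    lowerLevel-ℕ i j di dj lt dj<n = begin-strict
      i * n + dj * m            ≡⟨ cross-term K n i dj ⟩
      (i * 1 + dj * K) * n + dj <⟨ NP.+-monoʳ-< _ dj<n ⟩
      (i * 1 + dj * K) * n + n  ≡⟨ NP.+-comm _ n ⟩
      suc (i * 1 + dj * K) * n  ≤⟨ NP.*-monoˡ-≤ n lt ⟩
      (j * 1 + di * K) * n      ≤⟨ NP.m≤m+n _ di ⟩
      (j * 1 + di * K) * n + di ≡⟨ cross-term K n j di ⟨
      j * n + di * m            ∎
      where open NP.≤-Reasoning

  csLevel-sameLevel : ∀ t {a b} → catLevel t a ≡ catLevel t b → a F.< b → csLevel t b Z.< csLevel t a
  csLevel-sameLevel t {a} {b} eq a<b = Equivalence.from (heightAt-<⇔ n m (+ n) (toℕ b) db (toℕ a) da)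
    (sameLevel-ℕ (toℕ a) (toℕ b) da db (Equivalence.to (heightAt-≡⇔ 1 K (+ 0) (toℕ a) da (toℕ b) db) eq) a<b)
    where
    da db : ℕ
    da = downsBefore t (toℕ a)
    db = downsBefore t (toℕ b)

  csLevel-lowerLevel : ∀ t → CatalanFrom (+ 0) t → ups t ≡ K * n →
    ∀ {a b} → catLevel t a Z.< catLevel t b → csLevel t a Z.< csLevel t b
  csLevel-lowerLevel t cat ups≡Kn {a} {b} lt = Equivalence.from (heightAt-<⇔ n m (+ n) (toℕ a) da (toℕ b) db)
    (lowerLevel-ℕ (toℕ a) (toℕ b) da db (Equivalence.to (heightAt-<⇔ 1 K (+ 0) (toℕ a) da (toℕ b) db) lt) (downsBefore<n t cat ups≡Kn b))
    where
    da db : ℕ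
    da = downsBefore t (toℕ a)
    db = downsBefore t (toℕ b)

  SmallerLabel : Path → Fin (K * n) → Fin (K * n) → Set
  SmallerLabel t a b = catLevel t a Z.< catLevel t b ⊎ (catLevel t a ≡ catLevel t b × b F.< a)

  smallerLabel-total : ∀ t a b → a ≡ b ⊎ SmallerLabel t a b ⊎ SmallerLabel t b a
  smallerLabel-total t a b with ZP.<-cmp (catLevel t a) (catLevel t b) | FP.<-cmp a b
  ... | tri< lt _ _ | _           = inj₂ (inj₁ (inj₁ lt))
  ... | tri> _ _ gt | _           = inj₂ (inj₂ (inj₁ gt))
  ... | tri≈ _ eq _ | tri< lt _ _ = inj₂ (inj₂ (inj₂ (sym eq , lt)))
  ... | tri≈ _ _ _  | tri≈ _ eq _ = inj₁ eq
  ... | tri≈ _ eq _ | tri> _ _ gt = inj₂ (inj₁ (inj₂ (eq , gt)))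

  csLevel-monotone : ∀ t → CatalanFrom (+ 0) t → ups t ≡ K * n →
    ∀ {a b} → SmallerLabel t a b → csLevel t a Z.< csLevel t b
  csLevel-monotone t cat ups≡Kn (inj₁ lt)        = csLevel-lowerLevel t cat ups≡Kn lt
  csLevel-monotone t cat ups≡Kn (inj₂ (eq , b<a)) = csLevel-sameLevel t (sym eq) b<a

  length-catalan : ∀ t → ups t ≡ K * n → downs t ≡ n → length t ≡ suc K * n
  length-catalan t ups≡Kn downs≡n = trans (length≡ups+downs t) (trans (cong₂ _+_ ups≡Kn downs≡n) (NP.+-comm (K * n) n))

  short⇒labelled : (σ : Perm (K * n)) → IsShortCSPerm (suc K) n σ → IsLabelledCatalanPerm (suc K) n σ
  short⇒labelled σ ([] , (() , _) , _)
  short⇒labelled σ (false ∷ t , (_ , 1+downs≡n , positive , _) , _) =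
    ⊥-elim (0≮-m (take-heights-head (+ n) (+ m) (+ 0 Z.- + m) t (suc K * n) 0<Kn+n positive))
    where
    0≮-m : ¬ (+ 0 Z.< + 0 Z.- + m)
    0≮-m ()
    0<Kn+n : 0 N.< suc K * n
    0<Kn+n = NP.<-≤-trans (subst (0 N.<_) 1+downs≡n N.z<s) (NP.m≤m+n n (K * n))
  short⇒labelled σ (true ∷ t , (1+ups≡1+Kn , downs≡n , positive , end) , ℓ , ℓ-rises , σ-bij , σ⇔ℓ) =
    t , (ups≡Kn , downs≡n , cat) , catLevel t , sym (rises-catalan t ups≡Kn) , σ-bij ,
    (λ a b eq a<b → σ-mono (inj₂ (sym eq , a<b))) , (λ a b lt → σ-mono (inj₁ lt))
    where
    ups≡Kn : ups t ≡ K * n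
    ups≡Kn = NP.suc-injective 1+ups≡1+Kn
    cat : CatalanFrom (+ 0) t
    cat = Equivalence.from (catalan⇔positiveThenZero t 0 0 ups≡Kn downs≡n)
      (subst (λ L → PositiveThenZeroAt L (heights (+ n) (+ m) (+ n) t)) (sym (length-catalan t ups≡Kn downs≡n))
        (positive , end))
    ℓ≗csLevel : ∀ a → ℓ a ≡ csLevel t a
    ℓ≗csLevel = tabulate-injective (trans ℓ-rises (rises-cs t ups≡Kn))
    σ-mono : ∀ {a b} → SmallerLabel t a b → σ a F.< σ b
    σ-mono {a} {b} a≺b = Equivalence.from (σ⇔ℓ a b)
      (subst₂ Z._<_ (sym (ℓ≗csLevel a)) (sym (ℓ≗csLevel b)) (csLevel-monotone t cat ups≡Kn a≺b))

  labelled⇒short : (σ : Perm (K * n)) → IsLabelledCatalanPerm (suc K) n σ → IsShortCSPerm (suc K) n σ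
  labelled⇒short σ (t , (ups≡Kn , downs≡n , cat) , ℓ , ℓ-rises , σ-bij , σ-sameLevel , σ-lowerLevel) =
    true ∷ t , (cong suc ups≡Kn , downs≡n , positiveThenZero) , csLevel t , sym (rises-cs t ups≡Kn) , σ-bij ,
    monotone-agree (smallerLabel-total t) σ (csLevel t) σ-mono (csLevel-monotone t cat ups≡Kn)
    where
    positiveThenZero : PositiveThenZeroAt (suc K * n) (heights (+ n) (+ m) (+ n) t)
    positiveThenZero = subst (λ L → PositiveThenZeroAt L (heights (+ n) (+ m) (+ n) t)) (length-catalan t ups≡Kn downs≡n)
      (Equivalence.to (catalan⇔positiveThenZero t 0 0 ups≡Kn downs≡n) cat)
    ℓ≗catLevel : ∀ a → ℓ a ≡ catLevel t a
    ℓ≗catLevel = tabulate-injective (trans ℓ-rises (rises-catalan t ups≡Kn))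
    σ-mono : ∀ {a b} → SmallerLabel t a b → σ a F.< σ b
    σ-mono {a} {b} (inj₁ lt)        = σ-lowerLevel a b (subst₂ Z._<_ (sym (ℓ≗catLevel a)) (sym (ℓ≗catLevel b)) lt)
    σ-mono {a} {b} (inj₂ (eq , b<a)) = σ-sameLevel b a (trans (ℓ≗catLevel b) (trans (sym eq) (sym (ℓ≗catLevel a)))) b<a

proposition4p2 : (k n : ℕ) → 2 ≤ k → (σ : Perm ((k ∸ 1) * n)) →
    IsShortCSPerm k n σ ⇔ IsLabelledCatalanPerm k n σ
proposition4p2 zero    n () σ
proposition4p2 (suc K) n _  σ = mk⇔ (short⇒labelled σ) (labelled⇒short σ)
  where open CatalanSpitzer K n
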